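{- Let $p>3$ be a prime. Then $m(p)\ge p$, where $m(n)$ denotes the minimal integer $m$ such that there exist subsets $A_1,\ldots,A_m$ of $\{1,\ldots,4n\}$ with $|A_i|=2n$ for each $1\le i\le m$, having the property that for every subset $B\subseteq\{1,\ldots,4n\}$ with $|B|=2n$ there is at least one $i$, $1\le i\le m$, with $|A_i\cap B|=n$. -}

module Defs where

open import Data.Nat using (ℕ; _*_)
open import Data.Fin using (Fin)
open import Data.Fin.Subset using (Subset; _∩_; ∣_∣)
open import Data.Product using (∃-syntax; _×_)
open import Relation.Binary.PropositionalEquality using (_≡_)

-- The ground set {1,…,4n} is modelled as Fin (4 * n); a subset is a Subset (4 * n).
GoodFamily : (n m : ℕ) → (Fin m → Subset (4 * n)) → Set
GoodFamily n m A =
  ((i : Fin m) → ∣ A i ∣ ≡ 2 * n) ×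
  ((B : Subset (4 * n)) → ∣ B ∣ ≡ 2 * n → ∃[ i ] ∣ A i ∩ B ∣ ≡ n)

-- m(n) is the least m admitting a good family; "m(n) ≥ k" means every good family has size ≥ k.
-- (A good family always exists, e.g. all 2n-subsets, so m(n) is well defined.)
MinAtLeast : ℕ → ℕ → Set
MinAtLeast n k = (m : ℕ) (A : Fin m → Subset (4 * n)) → GoodFamily n m A → k Data.Nat.≤ m

module Submission where

-- Suppose A₁, …, A_m is a good family with m < p, and put f(B) = ∏ᵢ ∣Aᵢ ∩ B∣.
-- Since m < p there is a p-set T meeting every Aᵢ in strictly between 0 and p
-- points: take one point x₀ and, for each i, a point on the other side of Aᵢ
-- from x₀, and pad to size p.  Goodness makes p divide f(B) for every 2p-set B,
-- hence p divides the sum of f(B) over the 2p-sets B ⊇ T.  Writing each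
-- ∣Aᵢ ∩ B∣ as a sum over the points of Aᵢ reduces this sum to counts of 2p-sets
-- containing sets U ⊇ T, and C(4p − ∣U∣, 2p − ∣U∣) is ≡ 3 (mod p) for U = T and
-- ≡ 1 otherwise by Lucas' theorem.  So the sum is ≡ 2 f(T) + ∏ᵢ ∣Aᵢ∣, and as
-- p ∣ ∣Aᵢ∣ = 2p we get p ∣ 2 f(T), impossible for p > 3 by the choice of T.

open import Data.Bool.Base using (if_then_else_)
open import Data.Fin.Base using (Fin; zero; suc)
open import Data.Fin.Subset
open import Data.Fin.Subset.Properties
open import Data.Nat.Base
open import Data.Nat.Combinatorics using (_C_; nCn≡1; nC1≡n; nCk+nC[k+1]≡[n+1]C[k+1])
open import Data.Nat.Divisibility
open import Data.Nat.DivMod using (_%_; %-distribˡ-+; %-distribˡ-*)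
open import Data.Nat.Primality using (Prime; euclidsLemma; prime⇒nonZero; prime⇒nonTrivial)
open import Data.Nat.Properties
open import Algebra.Properties.Semiring.Sum +-*-semiring
  using (sum-syntax; sum-cong-≗; ∑-distrib-+; *-distribˡ-sum; *-distribʳ-sum)
open import Data.Nat.Tactic.RingSolver using (solve-∀)
open import Data.Product.Base as Product using (∃; _×_; _,_; proj₁)
open import Data.Sum.Base using (_⊎_; inj₁; inj₂)
open import Data.Vec.Base using ([]; _∷_; here; there)
open import Data.Vec.Functional using (foldr)
open import Function.Base using (_∘_)
open import Level using (0ℓ)
open import Relation.Binary.Bundles using (Setoid)
import Relation.Binary.Construct.On as On
open import Relation.Binary.PropositionalEquality
open import Relation.Nullary using (¬_; Dec; yes; no; does; contradiction)

open import Defs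

-- Defined through does, so that 𝟙 (x ∈? p), 𝟙 (p ⊆? q) and 𝟙 (m ≟ n) reduce on constructors.
𝟙 : ∀ {a} {P : Set a} → Dec P → ℕ
𝟙 P? = if does P? then 1 else 0

𝟙-yes : ∀ {a} {P : Set a} (P? : Dec P) → P → 𝟙 P? ≡ 1
𝟙-yes (yes _) _ = refl
𝟙-yes (no ¬P) P = contradiction P ¬P

𝟙-no : ∀ {a} {P : Set a} (P? : Dec P) → ¬ P → 𝟙 P? ≡ 0
𝟙-no (yes P) ¬P = contradiction P ¬P
𝟙-no (no _)  _  = refl

∏ : ∀ {m} → (Fin m → ℕ) → ℕ
∏ = foldr _*_ 1

∣∏ : ∀ {d m} (f : Fin m → ℕ) i → d ∣ f i → d ∣ ∏ f
∣∏ f zero    d∣fi = ∣m⇒∣m*n _ d∣fi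
∣∏ f (suc i) d∣fi = ∣n⇒∣m*n (f zero) (∣∏ (f ∘ suc) i d∣fi)

prime∤∏ : ∀ {p m} → Prime p → (f : Fin m → ℕ) → (∀ i → p ∤ f i) → p ∤ ∏ f
prime∤∏ {m = zero}  p-prime f p∤f p∣1 = nonTrivial⇒≢1 {{prime⇒nonTrivial p-prime}} (∣1⇒≡1 p∣1)
prime∤∏ {m = suc m} p-prime f p∤f p∣∏ with euclidsLemma (f zero) (∏ (f ∘ suc)) p-prime p∣∏
... | inj₁ p∣f₀ = p∤f zero p∣f₀
... | inj₂ p∣∏′ = prime∤∏ p-prime (f ∘ suc) (p∤f ∘ suc) p∣∏′

∑-affine : ∀ {n} (f g : Fin n → ℕ) c d →
           ∑[ x < n ] (f x * (c * g x + d)) ≡ c * ∑[ x < n ] (f x * g x) + d * ∑[ x < n ] f x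
∑-affine {n} f g c d = begin
  ∑[ x < n ] (f x * (c * g x + d))            ≡⟨ sum-cong-≗ (λ x → expand (f x) (g x) c d) ⟩
  ∑[ x < n ] (c * (f x * g x) + d * f x)      ≡⟨ ∑-distrib-+ (λ x → c * (f x * g x)) (λ x → d * f x) ⟩
  ∑[ x < n ] (c * (f x * g x)) + ∑[ x < n ] (d * f x)
    ≡⟨ sym (cong₂ _+_ (*-distribˡ-sum c (λ x → f x * g x)) (*-distribˡ-sum d f)) ⟩
  c * ∑[ x < n ] (f x * g x) + d * ∑[ x < n ] f x ∎
  where
  open ≡-Reasoning
  expand : ∀ a b c d → a * (c * b + d) ≡ c * (a * b) + d * a
  expand = solve-∀

module Modulo (p : ℕ) .{{_ : NonZero p}} where

  infix 4 _≈_
  _≈_ : ℕ → ℕ → Set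
  a ≈ b = a % p ≡ b % p

  ≈-setoid : Setoid 0ℓ 0ℓ
  ≈-setoid = On.setoid (setoid ℕ) (_% p)

  +-cong : ∀ {a b c d} → a ≈ b → c ≈ d → a + c ≈ b + d
  +-cong {a} {b} {c} {d} a≈b c≈d = begin
    (a + c) % p             ≡⟨ %-distribˡ-+ a c p ⟩
    (a % p + c % p) % p     ≡⟨ cong₂ (λ x y → (x + y) % p) a≈b c≈d ⟩
    (b % p + d % p) % p     ≡⟨ sym (%-distribˡ-+ b d p) ⟩
    (b + d) % p             ∎
    where open ≡-Reasoning

  *-congˡ : ∀ a {b c} → b ≈ c → a * b ≈ a * c
  *-congˡ a {b} {c} b≈c = begin
    (a * b) % p             ≡⟨ %-distribˡ-* a b p ⟩
    (a % p * (b % p)) % p   ≡⟨ cong (λ x → (a % p * x) % p) b≈c ⟩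
    (a % p * (c % p)) % p   ≡⟨ sym (%-distribˡ-* a c p) ⟩
    (a * c) % p             ∎
    where open ≡-Reasoning

  ∑-cong : ∀ {n} {f g : Fin n → ℕ} → (∀ x → f x ≈ g x) → ∑[ x < n ] f x ≈ ∑[ x < n ] g x
  ∑-cong {zero}  f≈g = refl
  ∑-cong {suc n} f≈g = +-cong (f≈g zero) (∑-cong (f≈g ∘ suc))

  ∣⇒≈0 : ∀ {a} → p ∣ a → a ≈ 0
  ∣⇒≈0 {a} p∣a = trans (n∣m⇒m%n≡0 a p p∣a) (sym (n∣m⇒m%n≡0 0 p (p ∣0)))

  ≈-resp-∣ : ∀ {a b} → a ≈ b → p ∣ a → p ∣ b
  ≈-resp-∣ {a} {b} a≈b p∣a = m%n≡0⇒n∣m b p (trans (sym a≈b) (n∣m⇒m%n≡0 a p p∣a))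

∣p∪q∣≤∣p∣+∣q∣ : ∀ {n} (p q : Subset n) → ∣ p ∪ q ∣ ≤ ∣ p ∣ + ∣ q ∣
∣p∪q∣≤∣p∣+∣q∣ []            []            = z≤n
∣p∪q∣≤∣p∣+∣q∣ (inside ∷ p)  (t ∷ q)       =
  s≤s (≤-trans (∣p∪q∣≤∣p∣+∣q∣ p q) (+-monoʳ-≤ ∣ p ∣ (∣p∣≤∣x∷p∣ t q)))
∣p∪q∣≤∣p∣+∣q∣ (outside ∷ p) (inside ∷ q)  =
  subst (suc ∣ p ∪ q ∣ ≤_) (sym (+-suc ∣ p ∣ ∣ q ∣)) (s≤s (∣p∪q∣≤∣p∣+∣q∣ p q))
∣p∪q∣≤∣p∣+∣q∣ (outside ∷ p) (outside ∷ q) = ∣p∪q∣≤∣p∣+∣q∣ p q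

∣p∪⁅x⁆∣≤∣p∣+1 : ∀ {n} (p : Subset n) x → ∣ p ∪ ⁅ x ⁆ ∣ ≤ ∣ p ∣ + 1
∣p∪⁅x⁆∣≤∣p∣+1 p x = subst (λ k → ∣ p ∪ ⁅ x ⁆ ∣ ≤ ∣ p ∣ + k) (∣⁅x⁆∣≡1 x) (∣p∪q∣≤∣p∣+∣q∣ p ⁅ x ⁆)

p⊆q∧∣q∣≤∣p∣⇒q⊆p : ∀ {n} {p q : Subset n} → p ⊆ q → ∣ q ∣ ≤ ∣ p ∣ → q ⊆ p
p⊆q∧∣q∣≤∣p∣⇒q⊆p {p = []}          {[]}          _   _  = λ ()
p⊆q∧∣q∣≤∣p∣⇒q⊆p {p = inside ∷ p}  {inside ∷ q}  p⊆q le =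
  in⊆in (p⊆q∧∣q∣≤∣p∣⇒q⊆p (drop-∷-⊆ p⊆q) (s≤s⁻¹ le))
p⊆q∧∣q∣≤∣p∣⇒q⊆p {p = inside ∷ p}  {outside ∷ q} p⊆q _  = contradiction (p⊆q here) λ ()
p⊆q∧∣q∣≤∣p∣⇒q⊆p {p = outside ∷ p} {inside ∷ q}  p⊆q le =
  contradiction (≤-trans le (p⊆q⇒∣p∣≤∣q∣ (drop-∷-⊆ p⊆q))) 1+n≰n
p⊆q∧∣q∣≤∣p∣⇒q⊆p {p = outside ∷ p} {outside ∷ q} p⊆q le =
  out⊆ (p⊆q∧∣q∣≤∣p∣⇒q⊆p (drop-∷-⊆ p⊆q) le)

x∈p⇒0<∣p∣ : ∀ {n x} {p : Subset n} → x ∈ p → 0 < ∣ p ∣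
x∈p⇒0<∣p∣ {n} {x} {p} x∈p = subst (_< ∣ p ∣) (∣⊥∣≡0 n) (p⊂q⇒∣p∣<∣q∣ (⊥⊆ , x , x∈p , ∉⊥))

0<∣p∣⇒nonempty : ∀ {n} {p : Subset n} → 0 < ∣ p ∣ → Nonempty p
0<∣p∣⇒nonempty {p = inside ∷ p}  _  = zero , here
0<∣p∣⇒nonempty {p = outside ∷ p} 0<∣p∣ = Product.map suc there (0<∣p∣⇒nonempty 0<∣p∣)

∣p∣<n⇒∃∉ : ∀ {n} {p : Subset n} → ∣ p ∣ < n → ∃ λ x → x ∉ p
∣p∣<n⇒∃∉ {n} {p} ∣p∣<n = Product.map₂ x∈∁p⇒x∉p
  (0<∣p∣⇒nonempty (subst (0 <_) (sym (∣∁p∣≡n∸∣p∣ p)) (m<n⇒0<n∸m ∣p∣<n)))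

0<∣p∩q∣<∣q∣ : ∀ {n x y} {p q : Subset n} → x ∈ q → y ∈ q → x ∈ p → y ∉ p →
              0 < ∣ p ∩ q ∣ × ∣ p ∩ q ∣ < ∣ q ∣
0<∣p∩q∣<∣q∣ {y = y} {p} {q} x∈q y∈q x∈p y∉p =
  x∈p⇒0<∣p∣ (x∈p∩q⁺ (x∈p , x∈q)) ,
  p⊂q⇒∣p∣<∣q∣ (p∩q⊆q p q , y , y∈q , y∉p ∘ proj₁ ∘ x∈p∩q⁻ p q)

∣p∣≡∑[x∈p] : ∀ {n} (p : Subset n) → ∣ p ∣ ≡ ∑[ x < n ] 𝟙 (x ∈? p)
∣p∣≡∑[x∈p] []            = refl
∣p∣≡∑[x∈p] (inside ∷ p)  = cong suc (∣p∣≡∑[x∈p] p)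
∣p∣≡∑[x∈p] (outside ∷ p) = ∣p∣≡∑[x∈p] p

∣p∩q∣≡∑[x∈p]*[x∈q] : ∀ {n} (p q : Subset n) → ∣ p ∩ q ∣ ≡ ∑[ x < n ] (𝟙 (x ∈? p) * 𝟙 (x ∈? q))
∣p∩q∣≡∑[x∈p]*[x∈q] []            []            = refl
∣p∩q∣≡∑[x∈p]*[x∈q] (inside ∷ p)  (inside ∷ q)  = cong suc (∣p∩q∣≡∑[x∈p]*[x∈q] p q)
∣p∩q∣≡∑[x∈p]*[x∈q] (inside ∷ p)  (outside ∷ q) = ∣p∩q∣≡∑[x∈p]*[x∈q] p q
∣p∩q∣≡∑[x∈p]*[x∈q] (outside ∷ p) (t ∷ q)       = ∣p∩q∣≡∑[x∈p]*[x∈q] p q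

[p∪⁅x⁆⊆q]≡[p⊆q]*[x∈q] : ∀ {n} (p q : Subset n) x → 𝟙 (p ∪ ⁅ x ⁆ ⊆? q) ≡ 𝟙 (p ⊆? q) * 𝟙 (x ∈? q)
[p∪⁅x⁆⊆q]≡[p⊆q]*[x∈q] (s ∷ p) (t ∷ q) zero rewrite ∪-identityʳ p with s | t
... | inside  | inside  = sym (*-identityʳ _)
... | outside | inside  = sym (*-identityʳ _)
... | inside  | outside = refl
... | outside | outside = sym (*-zeroʳ (𝟙 (p ⊆? q)))
[p∪⁅x⁆⊆q]≡[p⊆q]*[x∈q] (inside  ∷ p) (inside  ∷ q) (suc x) = [p∪⁅x⁆⊆q]≡[p⊆q]*[x∈q] p q x
[p∪⁅x⁆⊆q]≡[p⊆q]*[x∈q] (inside  ∷ p) (outside ∷ q) (suc x) = refl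
[p∪⁅x⁆⊆q]≡[p⊆q]*[x∈q] (outside ∷ p) (t ∷ q)       (suc x) = [p∪⁅x⁆⊆q]≡[p⊆q]*[x∈q] p q x

⊆-extend : ∀ {n k} (p : Subset n) → ∣ p ∣ ≤ k → k ≤ n → ∃ λ q → p ⊆ q × ∣ q ∣ ≡ k
⊆-extend [] _ z≤n = [] , (λ ()) , refl
⊆-extend (inside ∷ p) (s≤s ∣p∣≤k) (s≤s k≤n) =
  Product.map (inside ∷_) (Product.map in⊆in (cong suc)) (⊆-extend p ∣p∣≤k k≤n)
⊆-extend {suc n} {k} (outside ∷ p) ∣p∣≤k k≤1+n with k ≤? n
... | yes k≤n = Product.map (outside ∷_) (Product.map₁ out⊆) (⊆-extend p ∣p∣≤k k≤n)
... | no  k≰n = ⊤ , ⊆⊤ , trans (∣⊤∣≡n (suc n)) (≤-antisym (≰⇒> k≰n) k≤1+n)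

image : ∀ {m n} → (Fin m → Fin n) → Subset n
image {zero}  y = ⊥
image {suc m} y = ⁅ y zero ⁆ ∪ image (y ∘ suc)

∣image∣≤m : ∀ {m n} (y : Fin m → Fin n) → ∣ image y ∣ ≤ m
∣image∣≤m {zero} {n} y = ≤-reflexive (∣⊥∣≡0 n)
∣image∣≤m {suc m} y = ≤-trans (∣p∪q∣≤∣p∣+∣q∣ ⁅ y zero ⁆ _)
  (+-mono-≤ (≤-reflexive (∣⁅x⁆∣≡1 (y zero))) (∣image∣≤m (y ∘ suc)))

y∈image : ∀ {m n} (y : Fin m → Fin n) i → y i ∈ image y
y∈image y zero    = x∈p∪q⁺ (inj₁ (x∈⁅x⁆ (y zero)))
y∈image y (suc i) = x∈p∪q⁺ (inj₂ (y∈image (y ∘ suc) i))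

∑⊇ : ∀ {n} → Subset n → (Subset n → ℕ) → ℕ
∑⊇ []            g = g []
∑⊇ (inside ∷ p)  g = ∑⊇ p (g ∘ (inside ∷_))
∑⊇ (outside ∷ p) g = ∑⊇ p (g ∘ (outside ∷_)) + ∑⊇ p (g ∘ (inside ∷_))

infixl 10 ∑⊇
syntax ∑⊇ p (λ q → e) = ∑[ q ⊇ p ] e

∑⊇-cong : ∀ {n} (p : Subset n) {g h : Subset n → ℕ} → (∀ q → p ⊆ q → g q ≡ h q) → ∑⊇ p g ≡ ∑⊇ p h
∑⊇-cong []            g≡h = g≡h [] (λ ())
∑⊇-cong (inside ∷ p)  g≡h = ∑⊇-cong p (λ q p⊆q → g≡h (inside ∷ q) (in⊆in p⊆q))
∑⊇-cong (outside ∷ p) g≡h = cong₂ _+_ (∑⊇-cong p (λ q p⊆q → g≡h (outside ∷ q) (out⊆ p⊆q)))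
                                      (∑⊇-cong p (λ q p⊆q → g≡h (inside ∷ q) (out⊆ p⊆q)))

∑⊇-zero : ∀ {n} (p : Subset n) → ∑[ q ⊇ p ] 0 ≡ 0
∑⊇-zero []            = refl
∑⊇-zero (inside ∷ p)  = ∑⊇-zero p
∑⊇-zero (outside ∷ p) = cong₂ _+_ (∑⊇-zero p) (∑⊇-zero p)

∑⊇-*ˡ : ∀ {n} (p : Subset n) c g → ∑[ q ⊇ p ] (c * g q) ≡ c * ∑⊇ p g
∑⊇-*ˡ []            c g = refl
∑⊇-*ˡ (inside ∷ p)  c g = ∑⊇-*ˡ p c (g ∘ (inside ∷_))
∑⊇-*ˡ (outside ∷ p) c g = trans (cong₂ _+_ (∑⊇-*ˡ p c _) (∑⊇-*ˡ p c _)) (sym (*-distribˡ-+ c _ _))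

∑⊇-∑ : ∀ {n m} (p : Subset n) (f : Fin m → Subset n → ℕ) →
       ∑[ q ⊇ p ] ∑[ i < m ] f i q ≡ ∑[ i < m ] ∑⊇ p (f i)
∑⊇-∑ []            f = refl
∑⊇-∑ (inside ∷ p)  f = ∑⊇-∑ p (λ i → f i ∘ (inside ∷_))
∑⊇-∑ (outside ∷ p) f =
  trans (cong₂ _+_ (∑⊇-∑ p (λ i → f i ∘ (outside ∷_))) (∑⊇-∑ p (λ i → f i ∘ (inside ∷_))))
        (sym (∑-distrib-+ (λ i → ∑⊇ p (f i ∘ (outside ∷_))) (λ i → ∑⊇ p (f i ∘ (inside ∷_)))))

∑⊇-∣ : ∀ {n d} (p : Subset n) {g : Subset n → ℕ} → (∀ q → d ∣ g q) → d ∣ ∑⊇ p g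
∑⊇-∣ []            d∣g = d∣g []
∑⊇-∣ (inside ∷ p)  d∣g = ∑⊇-∣ p (d∣g ∘ (inside ∷_))
∑⊇-∣ (outside ∷ p) d∣g = ∣m∣n⇒∣m+n (∑⊇-∣ p (d∣g ∘ (outside ∷_))) (∑⊇-∣ p (d∣g ∘ (inside ∷_)))

∑⊇-[x∈q] : ∀ {n} (p : Subset n) x g → ∑[ q ⊇ p ] (𝟙 (x ∈? q) * g q) ≡ ∑⊇ (p ∪ ⁅ x ⁆) g
∑⊇-[x∈q] (s ∷ p) zero g rewrite ∪-identityʳ p with s
... | inside  = ∑⊇-cong p (λ q _ → *-identityˡ _)
... | outside = cong₂ _+_ (∑⊇-zero p) (∑⊇-cong p (λ q _ → *-identityˡ _))
∑⊇-[x∈q] (inside  ∷ p) (suc x) g = ∑⊇-[x∈q] p x (g ∘ (inside ∷_))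
∑⊇-[x∈q] (outside ∷ p) (suc x) g =
  cong₂ _+_ (∑⊇-[x∈q] p x (g ∘ (outside ∷_))) (∑⊇-[x∈q] p x (g ∘ (inside ∷_)))

∑⊇-∣∩∣ : ∀ {n} (p r : Subset n) g →
         ∑[ q ⊇ p ] (∣ r ∩ q ∣ * g q) ≡ ∑[ x < n ] (𝟙 (x ∈? r) * ∑⊇ (p ∪ ⁅ x ⁆) g)
∑⊇-∣∩∣ {n} p r g = begin
  ∑[ q ⊇ p ] (∣ r ∩ q ∣ * g q)
    ≡⟨ ∑⊇-cong p (λ q _ → expand q) ⟩
  ∑[ q ⊇ p ] ∑[ x < n ] (𝟙 (x ∈? r) * (𝟙 (x ∈? q) * g q))
    ≡⟨ ∑⊇-∑ p (λ x q → 𝟙 (x ∈? r) * (𝟙 (x ∈? q) * g q)) ⟩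
  ∑[ x < n ] ∑[ q ⊇ p ] (𝟙 (x ∈? r) * (𝟙 (x ∈? q) * g q))
    ≡⟨ sum-cong-≗ (λ x → ∑⊇-*ˡ p (𝟙 (x ∈? r)) (λ q → 𝟙 (x ∈? q) * g q)) ⟩
  ∑[ x < n ] (𝟙 (x ∈? r) * ∑[ q ⊇ p ] (𝟙 (x ∈? q) * g q))
    ≡⟨ sum-cong-≗ (λ x → cong (𝟙 (x ∈? r) *_) (∑⊇-[x∈q] p x g)) ⟩
  ∑[ x < n ] (𝟙 (x ∈? r) * ∑⊇ (p ∪ ⁅ x ⁆) g) ∎
  where
  open ≡-Reasoning
  expand : ∀ q → ∣ r ∩ q ∣ * g q ≡ ∑[ x < n ] (𝟙 (x ∈? r) * (𝟙 (x ∈? q) * g q))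
  expand q = begin
    ∣ r ∩ q ∣ * g q
      ≡⟨ cong (_* g q) (∣p∩q∣≡∑[x∈p]*[x∈q] r q) ⟩
    ∑[ x < n ] (𝟙 (x ∈? r) * 𝟙 (x ∈? q)) * g q
      ≡⟨ *-distribʳ-sum (g q) (λ x → 𝟙 (x ∈? r) * 𝟙 (x ∈? q)) ⟩
    ∑[ x < n ] (𝟙 (x ∈? r) * 𝟙 (x ∈? q) * g q)
      ≡⟨ sum-cong-≗ (λ x → *-assoc (𝟙 (x ∈? r)) (𝟙 (x ∈? q)) (g q)) ⟩
    ∑[ x < n ] (𝟙 (x ∈? r) * (𝟙 (x ∈? q) * g q)) ∎

∑⊇[∣q∣≡∣p∣+j] : ∀ {n} (p : Subset n) j → ∑[ q ⊇ p ] 𝟙 (∣ q ∣ ≟ ∣ p ∣ + j) ≡ (n ∸ ∣ p ∣) C j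
∑⊇[∣q∣≡∣p∣+j] []            zero    = refl
∑⊇[∣q∣≡∣p∣+j] []            (suc j) = refl
∑⊇[∣q∣≡∣p∣+j] (inside ∷ p)  j       = ∑⊇[∣q∣≡∣p∣+j] p j
∑⊇[∣q∣≡∣p∣+j] {suc n} (outside ∷ p) j =
  trans (split j) (cong (_C j) (sym (+-∸-assoc 1 (∣p∣≤n p))))
  where
  split : ∀ j → ∑[ q ⊇ p ] 𝟙 (∣ q ∣ ≟ ∣ p ∣ + j) + ∑[ q ⊇ p ] 𝟙 (suc ∣ q ∣ ≟ ∣ p ∣ + j)
                ≡ suc (n ∸ ∣ p ∣) C j
  split zero = cong₂ _+_ (∑⊇[∣q∣≡∣p∣+j] p 0) (trans (∑⊇-cong p too-big) (∑⊇-zero p))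
    where
    too-big : ∀ q → p ⊆ q → 𝟙 (suc ∣ q ∣ ≟ ∣ p ∣ + 0) ≡ 0
    too-big q p⊆q = 𝟙-no (suc ∣ q ∣ ≟ ∣ p ∣ + 0) λ eq →
      1+n≰n (≤-trans (≤-reflexive (trans eq (+-identityʳ ∣ p ∣))) (p⊆q⇒∣p∣≤∣q∣ p⊆q))
  split (suc j) = begin
    ∑[ q ⊇ p ] 𝟙 (∣ q ∣ ≟ ∣ p ∣ + suc j) + ∑[ q ⊇ p ] 𝟙 (suc ∣ q ∣ ≟ ∣ p ∣ + suc j)
      ≡⟨ cong (∑[ q ⊇ p ] 𝟙 (∣ q ∣ ≟ ∣ p ∣ + suc j) +_)
              (∑⊇-cong p (λ q _ → cong (𝟙 ∘ (suc ∣ q ∣ ≟_)) (+-suc ∣ p ∣ j))) ⟩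
    ∑[ q ⊇ p ] 𝟙 (∣ q ∣ ≟ ∣ p ∣ + suc j) + ∑[ q ⊇ p ] 𝟙 (∣ q ∣ ≟ ∣ p ∣ + j)
      ≡⟨ cong₂ _+_ (∑⊇[∣q∣≡∣p∣+j] p (suc j)) (∑⊇[∣q∣≡∣p∣+j] p j) ⟩
    (n ∸ ∣ p ∣) C suc j + (n ∸ ∣ p ∣) C j
      ≡⟨ +-comm ((n ∸ ∣ p ∣) C suc j) ((n ∸ ∣ p ∣) C j) ⟩
    (n ∸ ∣ p ∣) C j + (n ∸ ∣ p ∣) C suc j
      ≡⟨ nCk+nC[k+1]≡[n+1]C[k+1] (n ∸ ∣ p ∣) j ⟩
    suc (n ∸ ∣ p ∣) C suc j ∎
    where open ≡-Reasoning

[1+k]*[1+n]C[1+k]≡[1+n]*nCk : ∀ n k → suc k * (suc n C suc k) ≡ suc n * (n C k)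
[1+k]*[1+n]C[1+k]≡[1+n]*nCk n       zero    =
  trans (*-identityˡ (suc n C 1)) (trans (nC1≡n (suc n)) (sym (*-identityʳ (suc n))))
[1+k]*[1+n]C[1+k]≡[1+n]*nCk zero    (suc k) = *-zeroʳ (2 + k)
[1+k]*[1+n]C[1+k]≡[1+n]*nCk (suc n) (suc k) = begin
  (2 + k) * ((2 + n) C (2 + k))
    ≡⟨ cong ((2 + k) *_) (sym (nCk+nC[k+1]≡[n+1]C[k+1] (suc n) (suc k))) ⟩
  (2 + k) * ((1 + n) C (1 + k) + (1 + n) C (2 + k))
    ≡⟨ regroup k ((1 + n) C (1 + k)) ((1 + n) C (2 + k)) ⟩
  (1 + k) * ((1 + n) C (1 + k)) + (1 + n) C (1 + k) + (2 + k) * ((1 + n) C (2 + k))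
    ≡⟨ cong₂ (λ a b → a + (1 + n) C (1 + k) + b)
             ([1+k]*[1+n]C[1+k]≡[1+n]*nCk n k) ([1+k]*[1+n]C[1+k]≡[1+n]*nCk n (suc k)) ⟩
  (1 + n) * (n C k) + (1 + n) C (1 + k) + (1 + n) * (n C (1 + k))
    ≡⟨ cong (λ a → (1 + n) * (n C k) + a + (1 + n) * (n C (1 + k)))
            (sym (nCk+nC[k+1]≡[n+1]C[k+1] n k)) ⟩
  (1 + n) * (n C k) + (n C k + n C (1 + k)) + (1 + n) * (n C (1 + k))
    ≡⟨ collect n (n C k) (n C (1 + k)) ⟩
  (2 + n) * (n C k + n C (1 + k))
    ≡⟨ cong ((2 + n) *_) (nCk+nC[k+1]≡[n+1]C[k+1] n k) ⟩
  (2 + n) * ((1 + n) C (1 + k)) ∎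
  where
  open ≡-Reasoning
  regroup : ∀ k a b → (2 + k) * (a + b) ≡ (1 + k) * a + a + (2 + k) * b
  regroup = solve-∀
  collect : ∀ n a b → (1 + n) * a + (a + b) + (1 + n) * b ≡ (2 + n) * (a + b)
  collect = solve-∀

p∣pCk : ∀ {p k} → Prime p → 0 < k → k < p → p ∣ p C k
p∣pCk {suc p} {suc k} p-prime _ k<p with euclidsLemma (suc k) (suc p C suc k) p-prime p∣k*pCk
  where
  p∣k*pCk : suc p ∣ suc k * (suc p C suc k)
  p∣k*pCk = divides (p C k) (trans ([1+k]*[1+n]C[1+k]≡[1+n]*nCk p k) (*-comm (suc p) (p C k)))
... | inj₁ p∣k   = contradiction p∣k (>⇒∤ k<p)
... | inj₂ p∣pCk = p∣pCk

module BinomialsModPrime {p : ℕ} (p-prime : Prime p) where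

  instance
    p≢0 : NonZero p
    p≢0 = prime⇒nonZero p-prime

  open Modulo p
  open import Relation.Binary.Reasoning.Setoid ≈-setoid

  [n+p]Ck≈nCk+[k≡p] : ∀ n {k} → k ≤ p → (n + p) C k ≈ n C k + 𝟙 (k ≟ p)
  [n+p]Ck≈nCk+[k≡p] n       {zero}  _ = cong (λ b → (1 + b) % p) (sym (𝟙-no (0 ≟ p) (≢-nonZero⁻¹ p ∘ sym)))
  [n+p]Ck≈nCk+[k≡p] zero    {suc k} 1+k≤p with suc k ≟ p
  ... | yes 1+k≡p = cong (_% p) (trans (trans (cong (p C_) 1+k≡p) (nCn≡1 p))
                                            (sym (𝟙-yes (suc k ≟ p) 1+k≡p)))
  ... | no  1+k≢p = trans (∣⇒≈0 (p∣pCk p-prime (s≤s z≤n) (≤∧≢⇒< 1+k≤p 1+k≢p)))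
                          (cong (_% p) (sym (𝟙-no (suc k ≟ p) 1+k≢p)))
  [n+p]Ck≈nCk+[k≡p] (suc n) {suc k} 1+k≤p = begin
    (suc n + p) C suc k
      ≡⟨ sym (nCk+nC[k+1]≡[n+1]C[k+1] (n + p) k) ⟩
    (n + p) C k + (n + p) C suc k
      ≈⟨ +-cong ([n+p]Ck≈nCk+[k≡p] n (<⇒≤ 1+k≤p)) ([n+p]Ck≈nCk+[k≡p] n 1+k≤p) ⟩
    n C k + 𝟙 (k ≟ p) + (n C suc k + 𝟙 (suc k ≟ p))
      ≡⟨ cong (λ b → n C k + b + (n C suc k + 𝟙 (suc k ≟ p))) (𝟙-no (k ≟ p) (<⇒≢ 1+k≤p)) ⟩
    n C k + 0 + (n C suc k + 𝟙 (suc k ≟ p))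
      ≡⟨ regroup (n C k) (n C suc k) (𝟙 (suc k ≟ p)) ⟩
    n C k + n C suc k + 𝟙 (suc k ≟ p)
      ≡⟨ cong (_+ 𝟙 (suc k ≟ p)) (nCk+nC[k+1]≡[n+1]C[k+1] n k) ⟩
    suc n C suc k + 𝟙 (suc k ≟ p) ∎
    where
    regroup : ∀ a b c → a + 0 + (b + c) ≡ a + b + c
    regroup = solve-∀

  [v+p+p]Cv≈1 : ∀ {v} → v < p → (v + p + p) C v ≈ 1
  [v+p+p]Cv≈1 {v} v<p = begin
    (v + p + p) C v                  ≈⟨ [n+p]Ck≈nCk+[k≡p] (v + p) (<⇒≤ v<p) ⟩
    (v + p) C v + 𝟙 (v ≟ p)          ≈⟨ +-cong ([n+p]Ck≈nCk+[k≡p] v (<⇒≤ v<p)) refl ⟩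
    v C v + 𝟙 (v ≟ p) + 𝟙 (v ≟ p)    ≡⟨ cong₂ (λ a b → a + b + b) (nCn≡1 v) (𝟙-no (v ≟ p) (<⇒≢ v<p)) ⟩
    1 ∎

  [p+p+p]Cp≈3 : (p + p + p) C p ≈ 3
  [p+p+p]Cp≈3 = begin
    (p + p + p) C p                  ≈⟨ [n+p]Ck≈nCk+[k≡p] (p + p) ≤-refl ⟩
    (p + p) C p + 𝟙 (p ≟ p)          ≈⟨ +-cong ([n+p]Ck≈nCk+[k≡p] p ≤-refl) refl ⟩
    p C p + 𝟙 (p ≟ p) + 𝟙 (p ≟ p)    ≡⟨ cong₂ (λ a b → a + b + b) (nCn≡1 p) (𝟙-yes (p ≟ p) refl) ⟩
    3 ∎

module SupersetCongruence {p : ℕ} (p-prime : Prime p) {T : Subset (4 * p)} (∣T∣≡p : ∣ T ∣ ≡ p) where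

  open BinomialsModPrime p-prime
  open Modulo p
  open import Relation.Binary.Reasoning.Setoid ≈-setoid

  ∑⊇[∣B∣≡2p]≈ : ∀ {U} → T ⊆ U → ∣ U ∣ ≤ 2 * p → ∑[ B ⊇ U ] 𝟙 (∣ B ∣ ≟ 2 * p) ≈ 2 * 𝟙 (U ⊆? T) + 1
  ∑⊇[∣B∣≡2p]≈ {U} T⊆U ∣U∣≤2p = begin
    ∑[ B ⊇ U ] 𝟙 (∣ B ∣ ≟ 2 * p)
      ≡⟨ ∑⊇-cong U (λ B _ → cong (𝟙 ∘ (∣ B ∣ ≟_)) (sym u+v≡2p)) ⟩
    ∑[ B ⊇ U ] 𝟙 (∣ B ∣ ≟ ∣ U ∣ + v)
      ≡⟨ ∑⊇[∣q∣≡∣p∣+j] U v ⟩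
    (4 * p ∸ ∣ U ∣) C v
      ≡⟨ cong (λ n → (n ∸ ∣ U ∣) C v) 4p≡u+[v+p+p] ⟩
    (∣ U ∣ + (v + p + p) ∸ ∣ U ∣) C v
      ≡⟨ cong (_C v) (m+n∸m≡n ∣ U ∣ (v + p + p)) ⟩
    (v + p + p) C v
      ≈⟨ binomial (U ⊆? T) ⟩
    2 * 𝟙 (U ⊆? T) + 1 ∎
    where
    v = 2 * p ∸ ∣ U ∣
    u+v≡2p : ∣ U ∣ + v ≡ 2 * p
    u+v≡2p = m+[n∸m]≡n ∣U∣≤2p
    u+v≡p+p : ∣ U ∣ + v ≡ p + p
    u+v≡p+p = trans u+v≡2p (cong (p +_) (+-identityʳ p))
    4p≡u+[v+p+p] : 4 * p ≡ ∣ U ∣ + (v + p + p)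
    4p≡u+[v+p+p] = trans (four p) (trans (cong (λ a → a + p + p) (sym u+v≡2p)) (reassoc ∣ U ∣ v p))
      where
      four : ∀ p → 4 * p ≡ 2 * p + p + p
      four = solve-∀
      reassoc : ∀ u v p → u + v + p + p ≡ u + (v + p + p)
      reassoc = solve-∀
    p≤u : p ≤ ∣ U ∣
    p≤u = subst (_≤ ∣ U ∣) ∣T∣≡p (p⊆q⇒∣p∣≤∣q∣ T⊆U)
    binomial : (U⊆?T : Dec (U ⊆ T)) → (v + p + p) C v ≈ 2 * 𝟙 U⊆?T + 1
    binomial (yes U⊆T) = subst (λ w → (w + p + p) C w ≈ 3) (sym v≡p) [p+p+p]Cp≈3
      where
      u≡p : ∣ U ∣ ≡ p
      u≡p = trans (cong ∣_∣ (⊆-antisym U⊆T T⊆U)) ∣T∣≡p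
      v≡p : v ≡ p
      v≡p = +-cancelˡ-≡ p v p (subst (λ u → u + v ≡ p + p) u≡p u+v≡p+p)
    binomial (no U⊈T) = [v+p+p]Cv≈1 v<p
      where
      p<u : p < ∣ U ∣
      p<u = ≤∧≢⇒< p≤u λ p≡u →
        U⊈T (p⊆q∧∣q∣≤∣p∣⇒q⊆p T⊆U (≤-reflexive (trans (sym p≡u) (sym ∣T∣≡p))))
      v<p : v < p
      v<p = +-cancelˡ-< p v p (subst (p + v <_) u+v≡p+p (+-monoˡ-< v p<u))

  -- Each factor ∣Aᵢ ∩ B∣ is expanded over a point x, which joins U; the size bound keeps
  -- every set reached this way within the range of ∑⊇[∣B∣≡2p]≈.
  ∑⊇[∏∣A∩B∣*[∣B∣≡2p]]≈ : ∀ {m} (A : Fin m → Subset (4 * p)) {U} → T ⊆ U → ∣ U ∣ + m ≤ 2 * p →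
    ∑[ B ⊇ U ] (∏ (λ i → ∣ A i ∩ B ∣) * 𝟙 (∣ B ∣ ≟ 2 * p))
      ≈ 2 * 𝟙 (U ⊆? T) * ∏ (λ i → ∣ A i ∩ T ∣) + ∏ (λ i → ∣ A i ∣)
  ∑⊇[∏∣A∩B∣*[∣B∣≡2p]]≈ {zero} A {U} T⊆U ∣U∣+0≤2p = begin
    ∑[ B ⊇ U ] (1 * 𝟙 (∣ B ∣ ≟ 2 * p))
      ≡⟨ ∑⊇-cong U (λ B _ → *-identityˡ _) ⟩
    ∑[ B ⊇ U ] 𝟙 (∣ B ∣ ≟ 2 * p)
      ≈⟨ ∑⊇[∣B∣≡2p]≈ T⊆U (subst (_≤ 2 * p) (+-identityʳ ∣ U ∣) ∣U∣+0≤2p) ⟩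
    2 * 𝟙 (U ⊆? T) + 1
      ≡⟨ cong (_+ 1) (sym (*-identityʳ _)) ⟩
    2 * 𝟙 (U ⊆? T) * 1 + 1 ∎
  ∑⊇[∏∣A∩B∣*[∣B∣≡2p]]≈ {suc m} A {U} T⊆U ∣U∣+1+m≤2p = begin
    ∑[ B ⊇ U ] (∣ A₀ ∩ B ∣ * P B * e B)
      ≡⟨ ∑⊇-cong U (λ B _ → *-assoc ∣ A₀ ∩ B ∣ (P B) (e B)) ⟩
    ∑[ B ⊇ U ] (∣ A₀ ∩ B ∣ * (P B * e B))
      ≡⟨ ∑⊇-∣∩∣ U A₀ (λ B → P B * e B) ⟩
    ∑[ x < 4 * p ] (𝟙 (x ∈? A₀) * ∑[ B ⊇ (U ∪ ⁅ x ⁆) ] (P B * e B))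
      ≈⟨ ∑-cong (λ x → *-congˡ (𝟙 (x ∈? A₀))
           (∑⊇[∏∣A∩B∣*[∣B∣≡2p]]≈ (A ∘ suc) (⊆-trans T⊆U (p⊆p∪q ⁅ x ⁆)) (bound x))) ⟩
    ∑[ x < 4 * p ] (𝟙 (x ∈? A₀) * (2 * 𝟙 (U ∪ ⁅ x ⁆ ⊆? T) * P T + H))
      ≡⟨ sum-cong-≗ (λ x → cong (λ s → 𝟙 (x ∈? A₀) * (s + H)) (factor x)) ⟩
    ∑[ x < 4 * p ] (𝟙 (x ∈? A₀) * (c * 𝟙 (x ∈? T) + H))
      ≡⟨ ∑-affine (λ x → 𝟙 (x ∈? A₀)) (λ x → 𝟙 (x ∈? T)) c H ⟩
    c * ∑[ x < 4 * p ] (𝟙 (x ∈? A₀) * 𝟙 (x ∈? T)) + H * ∑[ x < 4 * p ] 𝟙 (x ∈? A₀)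
      ≡⟨ sym (cong₂ (λ a b → c * a + H * b) (∣p∩q∣≡∑[x∈p]*[x∈q] A₀ T) (∣p∣≡∑[x∈p] A₀)) ⟩
    c * ∣ A₀ ∩ T ∣ + H * ∣ A₀ ∣
      ≡⟨ rearrange (𝟙 (U ⊆? T)) (P T) (∣ A₀ ∩ T ∣) H (∣ A₀ ∣) ⟩
    2 * 𝟙 (U ⊆? T) * (∣ A₀ ∩ T ∣ * P T) + ∣ A₀ ∣ * H ∎
    where
    A₀ = A zero
    P : Subset (4 * p) → ℕ
    P B = ∏ (λ i → ∣ A (suc i) ∩ B ∣)
    e : Subset (4 * p) → ℕ
    e B = 𝟙 (∣ B ∣ ≟ 2 * p)
    H = ∏ (λ i → ∣ A (suc i) ∣)
    c = 2 * 𝟙 (U ⊆? T) * P T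
    bound : ∀ x → ∣ U ∪ ⁅ x ⁆ ∣ + m ≤ 2 * p
    bound x = ≤-trans (+-monoˡ-≤ m (∣p∪⁅x⁆∣≤∣p∣+1 U x))
                      (≤-trans (≤-reflexive (+-assoc ∣ U ∣ 1 m)) ∣U∣+1+m≤2p)
    factor : ∀ x → 2 * 𝟙 (U ∪ ⁅ x ⁆ ⊆? T) * P T ≡ c * 𝟙 (x ∈? T)
    factor x = trans (cong (λ s → 2 * s * P T) ([p∪⁅x⁆⊆q]≡[p⊆q]*[x∈q] U T x))
                     (swap (𝟙 (U ⊆? T)) (𝟙 (x ∈? T)) (P T))
      where
      swap : ∀ s t g → 2 * (s * t) * g ≡ 2 * s * g * t
      swap = solve-∀
    rearrange : ∀ s g a h b → 2 * s * g * a + h * b ≡ 2 * s * (a * g) + b * h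
    rearrange = solve-∀

Separates : ∀ {n} → Subset n → Fin n → Fin n → Set
Separates p x y = (x ∈ p × y ∉ p) ⊎ (y ∈ p × x ∉ p)

∃-separated : ∀ {n} {p : Subset n} → 0 < ∣ p ∣ → ∣ p ∣ < n → ∀ x → ∃ (Separates p x)
∃-separated {p = p} 0<∣p∣ ∣p∣<n x with x ∈? p
... | yes x∈p = Product.map₂ (λ y∉p → inj₁ (x∈p , y∉p)) (∣p∣<n⇒∃∉ ∣p∣<n)
... | no  x∉p = Product.map₂ (λ y∈p → inj₂ (y∈p , x∉p)) (0<∣p∣⇒nonempty 0<∣p∣)

separates⇒0<∣p∩q∣<∣q∣ : ∀ {n x y} {p q : Subset n} → x ∈ q → y ∈ q → Separates p x y →
                        0 < ∣ p ∩ q ∣ × ∣ p ∩ q ∣ < ∣ q ∣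
separates⇒0<∣p∩q∣<∣q∣ x∈q y∈q (inj₁ (x∈p , y∉p)) = 0<∣p∩q∣<∣q∣ x∈q y∈q x∈p y∉p
separates⇒0<∣p∩q∣<∣q∣ x∈q y∈q (inj₂ (y∈p , x∉p)) = 0<∣p∩q∣<∣q∣ y∈q x∈q y∈p x∉p

-- T contains the point zero and, for each i, a point that A i separates from it.
splittingSet : ∀ {m n k} (A : Fin m → Subset n) → (∀ i → 0 < ∣ A i ∣ × ∣ A i ∣ < n) → m < k → k ≤ n →
               ∃ λ T → ∣ T ∣ ≡ k × ∀ i → 0 < ∣ A i ∩ T ∣ × ∣ A i ∩ T ∣ < k
splittingSet {m} {suc n} {suc k} A proper m<k k≤n =
  let T , image⊆T , ∣T∣≡k = ⊆-extend (image points) (≤-trans (∣image∣≤m points) m<k) k≤n in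
  T , ∣T∣≡k , λ i → subst (λ t → 0 < ∣ A i ∩ T ∣ × ∣ A i ∩ T ∣ < t) ∣T∣≡k
    (separates⇒0<∣p∩q∣<∣q∣ (image⊆T (y∈image points zero)) (image⊆T (y∈image points (suc i)))
                           (Product.proj₂ (separated i)))
  where
  separated : ∀ i → ∃ (Separates (A i) zero)
  separated i = ∃-separated (Product.proj₁ (proper i)) (Product.proj₂ (proper i)) zero
  points : Fin (suc m) → Fin (suc n)
  points zero    = zero
  points (suc i) = proj₁ (separated i)

prime∤2∏+∏ : ∀ {p m} → Prime p → 3 < p → (f g : Fin m → ℕ) →
             (∀ i → p ∤ f i) → (∀ i → p ∣ g i) → p ∤ 2 * ∏ f + ∏ g
prime∤2∏+∏ {m = zero}  p-prime 3<p f g _   _   p∣3   = <⇒≱ 3<p (∣⇒≤ p∣3)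
prime∤2∏+∏ {p} {suc m} p-prime 3<p f g p∤f p∣g p∣sum
  with euclidsLemma 2 (∏ f) p-prime
         (∣m+n∣m⇒∣n (subst (p ∣_) (+-comm (2 * ∏ f) (∏ g)) p∣sum) (∣∏ g zero (p∣g zero)))
... | inj₁ p∣2  = <⇒≱ (<-trans (n<1+n 2) 3<p) (∣⇒≤ p∣2)
... | inj₂ p∣∏f = prime∤∏ p-prime f p∤f p∣∏f

splittingSet⇒¬GoodFamily : ∀ {p m} → Prime p → 3 < p → m < p → (A : Fin m → Subset (4 * p))
  (T : Subset (4 * p)) → ∣ T ∣ ≡ p → (∀ i → 0 < ∣ A i ∩ T ∣ × ∣ A i ∩ T ∣ < p) → ¬ GoodFamily p m A
splittingSet⇒¬GoodFamily {p} {m} p-prime 3<p m<p A T ∣T∣≡p 0<∣Aᵢ∩T∣<p (∣A∣≡2p , meets) =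
  prime∤2∏+∏ p-prime 3<p (λ i → ∣ A i ∩ T ∣) (λ i → ∣ A i ∣) p∤∣Aᵢ∩T∣ p∣∣Aᵢ∣ p∣2∏∣Aᵢ∩T∣+∏∣Aᵢ∣
  where
  instance
    p≢0 : NonZero p
    p≢0 = prime⇒nonZero p-prime
  open SupersetCongruence p-prime {T} ∣T∣≡p
  open Modulo p
  p∤∣Aᵢ∩T∣ : ∀ i → p ∤ ∣ A i ∩ T ∣
  p∤∣Aᵢ∩T∣ i = let 0<∣Aᵢ∩T∣ , ∣Aᵢ∩T∣<p = 0<∣Aᵢ∩T∣<p i in >⇒∤ {{>-nonZero 0<∣Aᵢ∩T∣}} ∣Aᵢ∩T∣<p
  p∣∣Aᵢ∣ : ∀ i → p ∣ ∣ A i ∣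
  p∣∣Aᵢ∣ i = subst (p ∣_) (sym (∣A∣≡2p i)) (n∣m*n 2)
  ∣T∣+m≤2p : ∣ T ∣ + m ≤ 2 * p
  ∣T∣+m≤2p = subst (λ t → t + m ≤ 2 * p) (sym ∣T∣≡p)
               (+-monoʳ-≤ p (≤-trans (<⇒≤ m<p) (≤-reflexive (sym (+-identityʳ p)))))
  p∣summand : ∀ B → (d : Dec (∣ B ∣ ≡ 2 * p)) → p ∣ ∏ (λ i → ∣ A i ∩ B ∣) * 𝟙 d
  p∣summand B (yes ∣B∣≡2p) = let i , ∣Aᵢ∩B∣≡p = meets B ∣B∣≡2p in
    ∣m⇒∣m*n 1 (∣∏ (λ i → ∣ A i ∩ B ∣) i (∣-reflexive (sym ∣Aᵢ∩B∣≡p)))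
  p∣summand B (no _) = ∣n⇒∣m*n (∏ (λ i → ∣ A i ∩ B ∣)) (p ∣0)
  p∣∑ : p ∣ ∑[ B ⊇ T ] (∏ (λ i → ∣ A i ∩ B ∣) * 𝟙 (∣ B ∣ ≟ 2 * p))
  p∣∑ = ∑⊇-∣ T (λ B → p∣summand B (∣ B ∣ ≟ 2 * p))
  p∣2∏∣Aᵢ∩T∣+∏∣Aᵢ∣ : p ∣ 2 * ∏ (λ i → ∣ A i ∩ T ∣) + ∏ (λ i → ∣ A i ∣)
  p∣2∏∣Aᵢ∩T∣+∏∣Aᵢ∣ = subst (λ s → p ∣ 2 * s * ∏ (λ i → ∣ A i ∩ T ∣) + ∏ (λ i → ∣ A i ∣))
    (𝟙-yes (T ⊆? T) ⊆-refl) (≈-resp-∣ (∑⊇[∏∣A∩B∣*[∣B∣≡2p]]≈ A ⊆-refl ∣T∣+m≤2p) p∣∑)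

noSmallGoodFamily : ∀ {p m} → Prime p → 3 < p → m < p → (A : Fin m → Subset (4 * p)) →
                    ¬ GoodFamily p m A
noSmallGoodFamily {p} p-prime 3<p m<p A good@(∣A∣≡2p , _) =
  let T , ∣T∣≡p , splits = splittingSet A proper m<p (m≤n*m p 4) in
  splittingSet⇒¬GoodFamily p-prime 3<p m<p A T ∣T∣≡p splits good
  where
  instance
    p≢0 : NonZero p
    p≢0 = prime⇒nonZero p-prime
  proper : ∀ i → 0 < ∣ A i ∣ × ∣ A i ∣ < 4 * p
  proper i = subst (0 <_) (sym (∣A∣≡2p i)) (*-monoˡ-< p {0} {2} (s≤s z≤n)) ,
             subst (_< 4 * p) (sym (∣A∣≡2p i)) (*-monoˡ-< p {2} {4} (s≤s (s≤s (s≤s z≤n))))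

theorem1p3 : (p : ℕ) → Prime p → 3 < p → MinAtLeast p p
theorem1p3 p p-prime 3<p m A good with p ≤? m
... | yes p≤m = p≤m
... | no  p≰m = contradiction good (noSmallGoodFamily p-prime 3<p (≰⇒> p≰m) A)
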